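{- Let $N,n\in\mathbb{N}$ with $N\log n\ge e^{2000}$ (where $\log$ is to base $2$). Let $\mathcal{F}$ be a graph class and let $G,H$ be graphs on at most $n$ vertices. If $G\not\equiv_{\mathcal{F}_{\le N}}H$, then for a prime $p$ chosen uniformly at random among the primes with $N\log n<p\le(N\log n)^2$, the probability that $G\equiv^p_{\mathcal{F}_{\le N}}H$ is at most $\frac{2}{N\log n}$.
   Context: $\hom(F,G)$ is the number of homomorphisms $F\to G$. $G\equiv_{\mathcal{F}}H$ means $\hom(F,G)=\hom(F,H)$ for all $F\in\mathcal{F}$; $G\equiv^p_{\mathcal{F}}H$ means $\hom(F,G)\equiv\hom(F,H)\pmod p$ for all $F\in\mathcal{F}$. $\mathcal{F}_{\le N}:=\{F\in\mathcal{F}:|V(F)|\le N\}$. -}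

module Defs where

open import Data.Nat using (ℕ; zero; suc; _+_; _*_; _^_; _≤_; _<_; ∣_-_∣)
open import Data.Nat.Divisibility using (_∣_)
open import Data.Nat using (_!)
open import Data.Bool using (Bool; true; false; T; not; _∨_; _∧_)
open import Data.Fin using (Fin; zero; suc)
open import Data.List using (List; []; _∷_; map; concatMap; length; filterᵇ)
open import Data.Fin.Base using (Fin)
open import Data.List using (allFin)
open import Relation.Binary.PropositionalEquality using (_≡_)
open import Relation.Nullary using (¬_)

record Graph : Set where
  field
    order : ℕ
    adj   : Fin order → Fin order → Bool
    sym   : ∀ u v → adj u v ≡ adj v u
    irrefl : ∀ u → adj u u ≡ false
open Graph public

allᵇ : {A : Set} → (A → Bool) → List A → Bool
allᵇ p [] = true
allᵇ p (x ∷ xs) = p x ∧ allᵇ p xs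

consF : ∀ {k m} → Fin m → (Fin k → Fin m) → (Fin (suc k) → Fin m)
consF i f zero = i
consF i f (suc j) = f j

-- all functions Fin k → Fin m (each exactly once, extensionally)
allFuns : (k m : ℕ) → List (Fin k → Fin m)
allFuns zero m = (λ ()) ∷ []
allFuns (suc k) m = concatMap (λ i → map (consF i) (allFuns k m)) (allFin m)

isHom : (F G : Graph) → (Fin (order F) → Fin (order G)) → Bool
isHom F G f =
  allᵇ (λ u → allᵇ (λ v → not (adj F u v) ∨ adj G (f u) (f v))
                 (allFin (order F)))
      (allFin (order F))

hom : Graph → Graph → ℕ
hom F G = length (filterᵇ (isHom F G) (allFuns (order F) (order G)))

GraphClass : Set₁
GraphClass = Graph → Set

HomEquivLe : GraphClass → ℕ → Graph → Graph → Set
HomEquivLe 𝓕 N G H = ∀ F → 𝓕 F → order F ≤ N → hom F G ≡ hom F H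

HomEquivModLe : ℕ → GraphClass → ℕ → Graph → Graph → Set
HomEquivModLe p 𝓕 N G H =
  ∀ F → 𝓕 F → order F ≤ N → p ∣ ∣ hom F G - hom F H ∣

-- Real-number quantities, encoded exactly over ℕ.
-- Throughout, M = n ^ N, so that x := N log₂ n = log₂ M.

-- e = lim eNum k / k!,  eNum k = Σ_{j ≤ k} k!/j!  (partial sums of Σ 1/j!)
eNum : ℕ → ℕ
eNum zero = 1
eNum (suc k) = suc k * eNum k + 1

-- log₂ M ≥ e^2000 : since the partial sums s_k increase to e,
-- this holds iff  log₂ M ≥ s_k^2000  for all k, i.e.
-- 2^(eNum k ^ 2000) ≤ M^((k !) ^ 2000).
LogGeE2000 : ℕ → Set
LogGeE2000 M = ∀ k → 2 ^ (eNum k ^ 2000) ≤ M ^ ((k !) ^ 2000)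

-- log₂ M < p  iff  M < 2^p
LogLt : ℕ → ℕ → Set
LogLt M p = M < 2 ^ p

-- p ≤ (log₂ M)^2  iff  √p ≤ log₂ M  iff  every rational a/b ≤ √p
-- (b ≥ 1, a² ≤ p b²) satisfies a/b ≤ log₂ M, i.e. 2^a ≤ M^b.
LeLogSq : ℕ → ℕ → Set
LeLogSq p M = ∀ a b → 1 ≤ b → a * a ≤ p * (b * b) → 2 ^ a ≤ M ^ b

{-# OPTIONS --safe #-}
-- With M = n ^ N and L = ⌊log₂ M⌋, a graph F ∈ 𝓕 on at most N vertices with hom(F,G) ≠ hom(F,H)
-- gives 0 < d = |hom(F,G) − hom(F,H)| ≤ M < 2^(L+1), and every bad prime exceeds L and divides d.
-- So the b bad primes are distinct integers above L with product below 2^(L+1), while Chebyshev's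
-- bound 2^Y ≤ 6·Y^π(Y) (from Nair's m·C(2m,m) ∣ lcm(1,…,2m)) at Y = L² leaves P ≳ L²/(2 log₂ L) − L
-- primes in (L, L²]. Comparing the two gives (L+1)·b ≤ 2P, i.e. M^b ≤ 2^(2P). The comparison is
-- tight to leading order, so it also uses that distinct factors cannot all stay near L: beyond the
-- first h ≈ L/(2 log₂ L) of them, every t ≈ 4 log₂ L further factors double the product.
module Submission where

open import Defs
open import Data.Nat using (ℕ; _≤_; _*_; _^_)
open import Data.Nat.Primality using (Prime)
open import Data.List using (List; length)
open import Data.List.Membership.Propositional using (_∈_)
open import Data.List.Relation.Unary.Unique.Propositional using (Unique)
open import Data.Product using (_×_)
open import Function.Bundles using (_⇔_)
open import Relation.Nullary using (¬_)

open import Data.Nat using (zero; suc; _+_; _∸_; _<_; z≤n; s≤s; NonZero; >-nonZero; >-nonZero⁻¹;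
  _<?_; _≤?_; _≟_; ⌊_/2⌋; ∣_-_∣)
open import Data.Nat.Base using (nonTrivial⇒n>1)
open import Data.Nat.Properties
open import Data.Nat.Divisibility
open import Data.Nat.DivMod using (_/_; _%_; m/n*n≤m; m≡m%n+[m/n]*n; m%n<n)
open import Data.Nat.Coprimality using (Coprime; coprime-divisor)
open import Data.Nat.Primality
  using (euclidsLemma; prime⇒irreducible; prime⇒nonTrivial; prime⇒nonZero; ¬prime[0]; ¬prime[1])
open import Data.Nat.Primality.Factorisation using (factorise)
open import Data.Nat.Induction using (<-rec)
open import Data.Nat.ListAction using (product)
open import Data.Nat.ListAction.Properties using (product-++; product-↭)
open import Data.Nat.Tactic.RingSolver using (solve-∀)
open import Data.List using ([]; _∷_; map; concatMap; allFin; _++_; filter; applyUpTo; upTo)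
open import Data.List.Properties
  using (length-map; length-++; length-++-sucʳ; length-filter; length-tabulate; length-applyUpTo; length-upTo)
open import Data.List.Relation.Unary.All using (All; []; _∷_)
import Data.List.Relation.Unary.All as All
open import Data.List.Relation.Unary.All.Properties using (all-filter; filter⁺)
open import Data.List.Relation.Unary.AllPairs using ([]; _∷_)
open import Data.List.Relation.Unary.Any using (here; there)
import Data.List.Relation.Unary.Unique.Propositional.Properties as Unique
open import Data.List.Relation.Binary.Subset.Propositional using (_⊆_)
open import Data.List.Membership.Propositional.Properties
  using (∈-∃++; ∈-++⁻; ∈-++⁺ˡ; ∈-++⁺ʳ; ∈-applyUpTo⁺; ∈-upTo⁺)
open import Data.List.Relation.Binary.Permutation.Propositional using (_↭_; ↭-refl; ↭-trans; prep)
open import Data.List.Relation.Binary.Permutation.Propositional.Properties using (shift; ↭-length)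
open import Data.Product using (∃-syntax; _,_; proj₁; proj₂)
open import Data.Sum using (inj₁; inj₂)
open import Function using (id; _∘_)
open import Function.Bundles using (module Equivalence)
open import Relation.Nullary using (contradiction; yes; no)
open import Relation.Nullary.Decidable using (decidable-stable)
open import Relation.Unary using (Pred; Decidable)
open import Relation.Unary.Properties using (∁?)
open import Relation.Binary.PropositionalEquality
  using (_≡_; _≢_; refl; cong; cong₂; subst; module ≡-Reasoning)
import Relation.Binary.PropositionalEquality as ≡
open import Algebra.Properties.CommutativeSemigroup *-commutativeSemigroup
  using (interchange; x∙yz≈y∙xz; xy∙z≈zx∙y)

^-monoʳ-∣ : ∀ m {a b} → a ≤ b → m ^ a ∣ m ^ b
^-monoʳ-∣ m {a} {b} a≤b = divides (m ^ (b ∸ a)) (begin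
  m ^ b                 ≡⟨ cong (m ^_) (m+[n∸m]≡n a≤b) ⟨
  m ^ (a + (b ∸ a))     ≡⟨ ^-distribˡ-+-* m a (b ∸ a) ⟩
  m ^ a * m ^ (b ∸ a)   ≡⟨ *-comm (m ^ a) _ ⟩
  m ^ (b ∸ a) * m ^ a   ∎)
  where open ≡-Reasoning

^-cancelʳ-< : ∀ m .{{_ : NonZero m}} {a b} → m ^ a < m ^ b → a < b
^-cancelʳ-< m m^a<m^b = ≰⇒> λ b≤a → <⇒≱ m^a<m^b (^-monoʳ-≤ m b≤a)

^-distribʳ-* : ∀ m n o → (m * n) ^ o ≡ m ^ o * n ^ o
^-distribʳ-* m n zero    = refl
^-distribʳ-* m n (suc o) = ≡.trans (cong (m * n *_) (^-distribʳ-* m n o)) (interchange m n (m ^ o) (n ^ o))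

^-double : ∀ m n → m ^ (2 * n) ≡ (m * m) ^ n
^-double m n = ≡.trans (≡.sym (^-*-assoc m 2 n)) (cong (λ x → (m * x) ^ n) (*-identityʳ m))

integer-log : ∀ b → 1 < b → ∀ M → 1 ≤ M → ∃[ e ] b ^ e ≤ M × M < b ^ suc e
integer-log b 1<b 1 _ = 0 , ≤-refl , subst (1 <_) (≡.sym (*-identityʳ b)) 1<b
integer-log b 1<b (suc (suc M)) _ with integer-log b 1<b (suc M) (s≤s z≤n)
... | e , b^e≤1+M , 1+M<b^[1+e] with suc (suc M) <? b ^ suc e
...   | yes 2+M<b^[1+e] = e , m≤n⇒m≤1+n b^e≤1+M , 2+M<b^[1+e]
...   | no  2+M≮b^[1+e] = suc e , ≤-reflexive (≡.sym 2+M≡b^[1+e]) ,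
                          subst (_< b ^ suc (suc e)) (≡.sym 2+M≡b^[1+e]) (^-monoʳ-< b 1<b (n<1+n (suc e)))
  where
  2+M≡b^[1+e] : suc (suc M) ≡ b ^ suc e
  2+M≡b^[1+e] = ≤-antisym 1+M<b^[1+e] (≮⇒≥ 2+M≮b^[1+e])

prime⇒1<p : ∀ {p} → Prime p → 1 < p
prime⇒1<p p-prime = nonTrivial⇒n>1 _ {{prime⇒nonTrivial p-prime}}

prime∤⇒coprime : ∀ {p n} → Prime p → ¬ p ∣ n → Coprime p n
prime∤⇒coprime p-prime p∤n (d∣p , d∣n) with prime⇒irreducible p-prime d∣p
... | inj₁ d≡1 = d≡1
... | inj₂ refl = contradiction d∣n p∤n

coprime-*ˡ : ∀ {m n o} → Coprime m n → Coprime o n → Coprime (m * o) n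
coprime-*ˡ {m} {n} {o} m⊥n o⊥n {d} (d∣m*o , d∣n) = o⊥n (coprime-divisor d⊥m d∣m*o , d∣n)
  where
  d⊥m : Coprime d m
  d⊥m (e∣d , e∣m) = m⊥n (e∣m , ∣-trans e∣d d∣n)

coprime-^ˡ : ∀ {m n} a → Coprime m n → Coprime (m ^ a) n
coprime-^ˡ zero    _   (e∣1 , _) = ∣1⇒≡1 e∣1
coprime-^ˡ (suc a) m⊥n           = coprime-*ˡ m⊥n (coprime-^ˡ a m⊥n)

coprime⇒*∣ : ∀ {m n d} → Coprime m n → m ∣ d → n ∣ d → m * n ∣ d
coprime⇒*∣ {m} {n} m⊥n m∣k*n (divides k refl) =
  *-monoˡ-∣ n (coprime-divisor m⊥n (subst (m ∣_) (*-comm k n) m∣k*n))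

prime∤product : ∀ {p qs} → Prime p → All Prime qs → All (p ≢_) qs → ¬ p ∣ product qs
prime∤product p-prime [] [] p∣1 = ¬prime[1] (subst Prime (∣1⇒≡1 p∣1) p-prime)
prime∤product {qs = q ∷ qs} p-prime (q-prime ∷ qs-prime) (p≢q ∷ p∉qs) p∣q*Πqs
  with euclidsLemma q (product qs) p-prime p∣q*Πqs
... | inj₂ p∣Πqs = prime∤product p-prime qs-prime p∉qs p∣Πqs
... | inj₁ p∣q with prime⇒irreducible q-prime p∣q
...   | inj₁ refl = ¬prime[1] p-prime
...   | inj₂ p≡q  = p≢q p≡q

product-∣ : ∀ {ps d} → All Prime ps → Unique ps → All (_∣ d) ps → product ps ∣ d
product-∣ [] [] [] = 1∣ _
product-∣ (p-prime ∷ ps-prime) (p∉ps ∷ ps-unique) (p∣d ∷ ps∣d) =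
  coprime⇒*∣ (prime∤⇒coprime p-prime (prime∤product p-prime ps-prime p∉ps))
    p∣d (product-∣ ps-prime ps-unique ps∣d)

∃-prime-divisor : ∀ k → 1 < k → ∃[ p ] Prime p × p ∣ k
∃-prime-divisor (suc zero) (s≤s ())
∃-prime-divisor k@(suc (suc _)) _ with factorise k
... | record { factors = [] ; isFactorisation = () }
... | record { factors = p ∷ ps ; isFactorisation = k≡p*Πps ; factorsPrime = p-prime ∷ _ } =
  p , p-prime , subst (p ∣_) (≡.sym k≡p*Πps) (m∣m*n (product ps))

prime-power-split : ∀ {p} → Prime p → ∀ k → 1 ≤ k → ∃[ a ] ∃[ c ] k ≡ p ^ a * c × ¬ p ∣ c
prime-power-split {p} p-prime = <-rec _ split
  where
  split : ∀ k → (∀ {j} → j < k → 1 ≤ j → ∃[ a ] ∃[ c ] j ≡ p ^ a * c × ¬ p ∣ c) →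
          1 ≤ k → ∃[ a ] ∃[ c ] k ≡ p ^ a * c × ¬ p ∣ c
  split k rec 1≤k with p ∣? k
  ... | no p∤k = 0 , k , ≡.sym (*-identityˡ k) , p∤k
  ... | yes (divides zero refl) = contradiction 1≤k λ ()
  ... | yes (divides j@(suc _) refl)
      with a , c , j≡p^a*c , p∤c ← rec (m<m*n j p (prime⇒1<p p-prime)) (s≤s z≤n)
      = suc a , c , ≡.trans (cong (_* p) j≡p^a*c) (xy∙z≈zx∙y (p ^ a) c p) , p∤c

prime-powers-∣⇒∣ : ∀ {Y U} → (∀ {p} → Prime p → ∀ a → p ^ suc a ≤ Y → p ^ suc a ∣ U) →
                   ∀ k → 1 ≤ k → k ≤ Y → k ∣ U
prime-powers-∣⇒∣ {Y} {U} p^a∣U = <-rec _ step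
  where
  step : ∀ k → (∀ {j} → j < k → 1 ≤ j → j ≤ Y → j ∣ U) → 1 ≤ k → k ≤ Y → k ∣ U
  step 1 _ _ _ = 1∣ U
  step k@(suc (suc _)) rec _ k≤Y
    with p , p-prime , p∣k ← ∃-prime-divisor k (s≤s (s≤s z≤n))
    with prime-power-split p-prime k (s≤s z≤n)
  ... | zero , c , k≡1*c , p∤c =
    contradiction (subst (p ∣_) (≡.trans k≡1*c (*-identityˡ c)) p∣k) p∤c
  ... | a , zero , k≡p^a*0 , _ =
    contradiction (≡.trans k≡p^a*0 (*-zeroʳ (p ^ a))) λ ()
  ... | a@(suc a-1) , c@(suc _) , k≡p^a*c , p∤c = subst (_∣ U) (≡.sym k≡p^a*c)
    (coprime⇒*∣ (coprime-^ˡ a (prime∤⇒coprime p-prime p∤c))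
      (p^a∣U p-prime a-1 (≤-trans (≤-trans (m≤m*n (p ^ a) c) (≤-reflexive (≡.sym k≡p^a*c))) k≤Y))
      (rec c<k (s≤s z≤n) (≤-trans (<⇒≤ c<k) k≤Y)))
    where
    instance _ = prime⇒nonZero p-prime
    c<k : c < k
    c<k = subst (c <_) (≡.trans (*-comm c (p ^ a)) (≡.sym k≡p^a*c))
            (m<m*n c (p ^ a) (^-monoʳ-< p (prime⇒1<p p-prime) {0} {a} (s≤s z≤n)))

-- Chebyshev bound

module _ {Y : ℕ} (1≤Y : 1 ≤ Y) where

  powers-multiple : ∀ s → ∃[ u ] 1 ≤ u × u ≤ Y × (Prime s → ∀ a → s ^ a ≤ Y → s ^ a ∣ u)
  powers-multiple 0 = 1 , ≤-refl , 1≤Y , λ 0-prime → contradiction 0-prime ¬prime[0]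
  powers-multiple 1 = 1 , ≤-refl , 1≤Y , λ 1-prime → contradiction 1-prime ¬prime[1]
  powers-multiple s@(suc (suc _)) with integer-log s (s≤s (s≤s z≤n)) Y 1≤Y
  ... | e , s^e≤Y , Y<s^[1+e] = s ^ e , m^n>0 s e , s^e≤Y , λ _ a s^a≤Y →
    ^-monoʳ-∣ s (≤-pred (^-cancelʳ-< s {a} {suc e} (≤-<-trans s^a≤Y Y<s^[1+e])))

  prime-powers-multiple : ∀ S → ∃[ U ] 1 ≤ U × U ≤ Y ^ length S ×
    (∀ {p} → p ∈ S → Prime p → ∀ a → p ^ a ≤ Y → p ^ a ∣ U)
  prime-powers-multiple [] = 1 , ≤-refl , ≤-refl , λ ()
  prime-powers-multiple (s ∷ S)
    with u , 1≤u , u≤Y , s^a∣u ← powers-multiple s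
       | U , 1≤U , U≤Y^|S| , p^a∣U ← prime-powers-multiple S
    = u * U , *-mono-≤ 1≤u 1≤U , *-mono-≤ u≤Y U≤Y^|S| , p^a∣u*U
    where
    p^a∣u*U : ∀ {p} → p ∈ s ∷ S → Prime p → ∀ a → p ^ a ≤ Y → p ^ a ∣ u * U
    p^a∣u*U (here refl)  p-prime a p^a≤Y = ∣m⇒∣m*n U (s^a∣u p-prime a p^a≤Y)
    p^a∣u*U (there p∈S)  p-prime a p^a≤Y = ∣n⇒∣m*n u (p^a∣U p∈S p-prime a p^a≤Y)

common-multiple-bound : ∀ {Y} S → 1 ≤ Y → (∀ {p} → Prime p → p ≤ Y → p ∈ S) →
  ∃[ U ] 1 ≤ U × U ≤ Y ^ length S × (∀ k → 1 ≤ k → k ≤ Y → k ∣ U)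
common-multiple-bound {Y} S 1≤Y primes∈S
  with U , 1≤U , U≤Y^|S| , p^a∣U ← prime-powers-multiple 1≤Y S
  = U , 1≤U , U≤Y^|S| , prime-powers-∣⇒∣ λ p-prime a p^a≤Y →
      p^a∣U (primes∈S p-prime (≤-trans (p≤p^[1+a] p-prime a) p^a≤Y)) p-prime (suc a) p^a≤Y
  where
  p≤p^[1+a] : ∀ {p} → Prime p → ∀ a → p ≤ p ^ suc a
  p≤p^[1+a] {p} p-prime a = m≤m*n p (p ^ a) {{m^n≢0 p a {{prime⇒nonZero p-prime}}}}

-- binomial a b is the binomial coefficient (a + b choose a), via Pascal's rule.
binomial : ℕ → ℕ → ℕ
binomial zero    _       = 1
binomial (suc a) zero    = 1
binomial (suc a) (suc b) = binomial a (suc b) + binomial (suc a) b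

binomial-zeroʳ : ∀ a → binomial a 0 ≡ 1
binomial-zeroʳ zero    = refl
binomial-zeroʳ (suc a) = refl

binomial-pos : ∀ a b → 1 ≤ binomial a b
binomial-pos zero    _       = ≤-refl
binomial-pos (suc a) zero    = ≤-refl
binomial-pos (suc a) (suc b) = ≤-trans (binomial-pos a (suc b)) (m≤m+n _ _)

binomial-absorbˡ : ∀ a b → suc a * binomial (suc a) b ≡ suc (a + b) * binomial a b
binomial-absorbʳ : ∀ a b → suc b * binomial a (suc b) ≡ suc (a + b) * binomial a b

binomial-absorbˡ a zero =
  cong₂ (λ x y → suc x * y) (≡.sym (+-identityʳ a)) (≡.sym (binomial-zeroʳ a))
binomial-absorbˡ a (suc b) = begin
  suc a * (binomial a (suc b) + binomial (suc a) b)
    ≡⟨ *-distribˡ-+ (suc a) (binomial a (suc b)) _ ⟩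
  suc a * binomial a (suc b) + suc a * binomial (suc a) b
    ≡⟨ cong (suc a * binomial a (suc b) +_)
         (≡.trans (binomial-absorbˡ a b) (≡.sym (binomial-absorbʳ a b))) ⟩
  suc a * binomial a (suc b) + suc b * binomial a (suc b)
    ≡⟨ *-distribʳ-+ (binomial a (suc b)) (suc a) (suc b) ⟨
  suc (a + suc b) * binomial a (suc b) ∎
  where open ≡-Reasoning

binomial-absorbʳ zero    b = refl
binomial-absorbʳ (suc a) b = begin
  suc b * (binomial a (suc b) + binomial (suc a) b)
    ≡⟨ *-distribˡ-+ (suc b) (binomial a (suc b)) _ ⟩
  suc b * binomial a (suc b) + suc b * binomial (suc a) b
    ≡⟨ cong (_+ suc b * binomial (suc a) b)
         (≡.trans (binomial-absorbʳ a b) (≡.sym (binomial-absorbˡ a b))) ⟩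
  suc a * binomial (suc a) b + suc b * binomial (suc a) b
    ≡⟨ *-distribʳ-+ (binomial (suc a) b) (suc a) (suc b) ⟨
  suc (a + suc b) * binomial (suc a) b
    ≡⟨ cong (λ x → suc x * binomial (suc a) b) (+-suc a b) ⟩
  suc (suc a + b) * binomial (suc a) b ∎
  where open ≡-Reasoning

central-binomial-step : ∀ m → suc m * binomial (suc m) (suc m) ≡ 2 * (suc (2 * m) * binomial m m)
central-binomial-step m = begin
  suc m * binomial (suc m) (suc m)       ≡⟨ binomial-absorbˡ m (suc m) ⟩
  suc (m + suc m) * binomial m (suc m)   ≡⟨ double m (binomial m (suc m)) ⟩
  2 * (suc m * binomial m (suc m))       ≡⟨ cong (2 *_) (binomial-absorbʳ m m) ⟩
  2 * (suc (m + m) * binomial m m)       ≡⟨ cong (λ x → 2 * (suc (m + x) * binomial m m)) (+-identityʳ m) ⟨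
  2 * (suc (2 * m) * binomial m m)       ∎
  where
  open ≡-Reasoning
  double : ∀ m x → suc (m + suc m) * x ≡ 2 * (suc m * x)
  double = solve-∀

4^m≤central-binomial : ∀ m → 4 ^ m ≤ suc (2 * m) * binomial m m
4^m≤central-binomial zero    = ≤-refl
4^m≤central-binomial (suc m) = begin
  4 * 4 ^ m                                 ≤⟨ *-monoʳ-≤ 4 (4^m≤central-binomial m) ⟩
  4 * (suc (2 * m) * binomial m m)          ≡⟨ *-assoc 2 2 (suc (2 * m) * binomial m m) ⟩
  2 * (2 * (suc (2 * m) * binomial m m))    ≡⟨ cong (2 *_) (central-binomial-step m) ⟨
  2 * (suc m * binomial (suc m) (suc m))    ≡⟨ *-assoc 2 (suc m) _ ⟨
  2 * suc m * binomial (suc m) (suc m)      ≤⟨ *-monoˡ-≤ _ (n≤1+n (2 * suc m)) ⟩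
  suc (2 * suc m) * binomial (suc m) (suc m) ∎
  where open ≤-Reasoning

-- Nair's argument: h = m * binomial m r and h′ = (m + 1) * binomial (m + 1) r divide U and
-- h′ = h + Δ, so h * h′ ∣ U * Δ; and h * h′ = m * binomial m (r + 1) * Δ.
module _ {Y U : ℕ} (k∣U : ∀ k → 1 ≤ k → k ≤ Y → k ∣ U) where

  m*binomial∣ : ∀ r m → 1 ≤ m → m + r ≤ Y → m * binomial m r ∣ U
  m*binomial∣ zero m 1≤m m+0≤Y =
    subst (_∣ U) (≡.sym (≡.trans (cong (m *_) (binomial-zeroʳ m)) (*-identityʳ m)))
      (k∣U m 1≤m (subst (_≤ Y) (+-identityʳ m) m+0≤Y))
  m*binomial∣ (suc r) m 1≤m m+1+r≤Y =
    *-cancelʳ-∣ Δ {{>-nonZero 1≤Δ}} (subst (_∣ U * Δ) hh′≡mBΔ hh′∣UΔ)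
    where
    X B h h′ Δ : ℕ
    X  = binomial m r
    B  = binomial m (suc r)
    h  = m * X
    h′ = suc (m + r) * X
    Δ  = suc r * X
    1≤Δ : 1 ≤ Δ
    1≤Δ = *-mono-≤ {1} {suc r} (s≤s z≤n) (binomial-pos m r)
    h∣U : h ∣ U
    h∣U = m*binomial∣ r m 1≤m (≤-trans (+-monoʳ-≤ m (n≤1+n r)) m+1+r≤Y)
    h′∣U : h′ ∣ U
    h′∣U = subst (_∣ U) (binomial-absorbˡ m r)
      (m*binomial∣ r (suc m) (s≤s z≤n) (subst (_≤ Y) (+-suc m r) m+1+r≤Y))
    Uh′≡Uh+UΔ : U * h′ ≡ U * h + U * Δ
    Uh′≡Uh+UΔ = split U m r X
      where
      split : ∀ U m r X → U * (suc (m + r) * X) ≡ U * (m * X) + U * (suc r * X)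
      split = solve-∀
    hh′∣UΔ : h * h′ ∣ U * Δ
    hh′∣UΔ = ∣m+n∣m⇒∣n (subst (h * h′ ∣_) Uh′≡Uh+UΔ (*-monoˡ-∣ h′ h∣U))
                        (subst (_∣ U * h) (*-comm h′ h) (*-monoˡ-∣ h h′∣U))
    hh′≡mBΔ : h * h′ ≡ m * B * Δ
    hh′≡mBΔ = ≡.trans (cong (h *_) (≡.sym (binomial-absorbʳ m r))) (swap m X r B)
      where
      swap : ∀ m X r B → m * X * (suc r * B) ≡ m * B * (suc r * X)
      swap = solve-∀

chebyshev-central : ∀ {m} S → 1 ≤ m → (∀ {p} → Prime p → p ≤ 2 * m → p ∈ S) →
  4 ^ m ≤ 3 * (2 * m) ^ length S
chebyshev-central {m} S 1≤m primes∈S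
  with U , 1≤U , U≤[2m]^|S| , k∣U ← common-multiple-bound S (≤-trans 1≤m (m≤m+n m _)) primes∈S
  = begin
  4 ^ m                         ≤⟨ 4^m≤central-binomial m ⟩
  suc (2 * m) * binomial m m    ≤⟨ *-monoˡ-≤ (binomial m m) (+-monoˡ-≤ (2 * m) 1≤m) ⟩
  3 * m * binomial m m          ≡⟨ *-assoc 3 m (binomial m m) ⟩
  3 * (m * binomial m m)        ≤⟨ *-monoʳ-≤ 3 (∣⇒≤ {{>-nonZero 1≤U}}
                                     (m*binomial∣ k∣U m m 1≤m m+m≤2m)) ⟩
  3 * U                         ≤⟨ *-monoʳ-≤ 3 U≤[2m]^|S| ⟩
  3 * (2 * m) ^ length S        ∎
  where
  open ≤-Reasoning
  m+m≤2m : m + m ≤ 2 * m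
  m+m≤2m = +-monoʳ-≤ m (≤-reflexive (≡.sym (+-identityʳ m)))

⌊n/2⌋-bounds : ∀ n → 2 * ⌊ n /2⌋ ≤ n × n ≤ suc (2 * ⌊ n /2⌋)
⌊n/2⌋-bounds 0 = z≤n , z≤n
⌊n/2⌋-bounds 1 = z≤n , ≤-refl
⌊n/2⌋-bounds (suc (suc n)) with lower , upper ← ⌊n/2⌋-bounds n
  = subst (_≤ suc (suc n)) (≡.sym (*-suc 2 ⌊ n /2⌋)) (s≤s (s≤s lower)) ,
    subst (suc (suc n) ≤_) (cong suc (≡.sym (*-suc 2 ⌊ n /2⌋))) (s≤s (s≤s upper))

chebyshev : ∀ {Y} S → 2 ≤ Y → (∀ {p} → Prime p → p ≤ Y → p ∈ S) → 2 ^ Y ≤ 6 * Y ^ length S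
chebyshev {Y} S 2≤Y primes∈S with 2m≤Y , Y≤1+2m ← ⌊n/2⌋-bounds Y = begin
  2 ^ Y                          ≤⟨ ^-monoʳ-≤ 2 Y≤1+2m ⟩
  2 * 2 ^ (2 * m)                ≡⟨ cong (2 *_) (^-*-assoc 2 2 m) ⟨
  2 * 4 ^ m                      ≤⟨ *-monoʳ-≤ 2 (chebyshev-central S (⌊n/2⌋-mono 2≤Y)
                                      (λ p-prime p≤2m → primes∈S p-prime (≤-trans p≤2m 2m≤Y))) ⟩
  2 * (3 * (2 * m) ^ length S)   ≡⟨ *-assoc 2 3 ((2 * m) ^ length S) ⟨
  6 * (2 * m) ^ length S         ≤⟨ *-monoʳ-≤ 6 (^-monoˡ-≤ (length S) 2m≤Y) ⟩
  6 * Y ^ length S               ∎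
  where
  open ≤-Reasoning
  m : ℕ
  m = ⌊ Y /2⌋

-- Products of distinct integers

module _ {A : Set} where

  Unique-⊆⇒length≤ : ∀ {xs ys : List A} → Unique xs → xs ⊆ ys → length xs ≤ length ys
  Unique-⊆⇒length≤ [] _ = z≤n
  Unique-⊆⇒length≤ {x ∷ xs} (x∉xs ∷ xs-unique) x∷xs⊆ys
    with us , vs , refl ← ∈-∃++ (x∷xs⊆ys (here refl))
    = subst (suc (length xs) ≤_) (≡.sym (length-++-sucʳ us x vs))
        (s≤s (Unique-⊆⇒length≤ xs-unique xs⊆us++vs))
    where
    xs⊆us++vs : xs ⊆ us ++ vs
    xs⊆us++vs {z} z∈xs with ∈-++⁻ us (x∷xs⊆ys (there z∈xs))
    ... | inj₁ z∈us          = ∈-++⁺ˡ z∈us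
    ... | inj₂ (here refl)   = contradiction refl (All.lookup x∉xs z∈xs)
    ... | inj₂ (there z∈vs)  = ∈-++⁺ʳ us z∈vs

  filter-++-∁-↭ : ∀ {ℓ} {P : Pred A ℓ} (P? : Decidable P) xs → filter P? xs ++ filter (∁? P?) xs ↭ xs
  filter-++-∁-↭ P? [] = ↭-refl
  filter-++-∁-↭ P? (x ∷ xs) with P? x
  ... | yes _ = prep x (filter-++-∁-↭ P? xs)
  ... | no  _ = ↭-trans (shift x (filter P? xs) (filter (∁? P?) xs)) (prep x (filter-++-∁-↭ P? xs))

Unique-interval⇒length≤ : ∀ {c h xs} → Unique xs → All (λ x → c ≤ x × x < c + h) xs → length xs ≤ h
Unique-interval⇒length≤ {c} {h} {xs} xs-unique xs-bounded =
  subst (length xs ≤_) (length-applyUpTo (c +_) h) (Unique-⊆⇒length≤ xs-unique xs⊆[c,c+h[)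
  where
  xs⊆[c,c+h[ : xs ⊆ applyUpTo (c +_) h
  xs⊆[c,c+h[ {x} x∈xs with c≤x , x<c+h ← All.lookup xs-bounded x∈xs =
    subst (_∈ applyUpTo (c +_) h) (m+[n∸m]≡n c≤x)
      (∈-applyUpTo⁺ (c +_) (+-cancelˡ-< c _ _ (subst (_< c + h) (≡.sym (m+[n∸m]≡n c≤x)) x<c+h)))

^-length≤product : ∀ {a xs} → All (a ≤_) xs → a ^ length xs ≤ product xs
^-length≤product []           = ≤-refl
^-length≤product (a≤x ∷ a≤xs) = *-mono-≤ a≤x (^-length≤product a≤xs)

bernoulli : ∀ c h t → c ^ t * (c + t * h) ≤ c * (c + h) ^ t
bernoulli c h zero = ≤-reflexive (base c h)
  where
  base : ∀ c h → 1 * (c + 0 * h) ≡ c * 1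
  base = solve-∀
bernoulli c h (suc t) = begin
  c * c ^ t * (c + suc t * h)                          ≤⟨ m≤m+n _ _ ⟩
  c * c ^ t * (c + suc t * h) + c ^ t * (t * h * h)    ≡⟨ expand c h t (c ^ t) ⟩
  (c + h) * (c ^ t * (c + t * h))                      ≤⟨ *-monoʳ-≤ (c + h) (bernoulli c h t) ⟩
  (c + h) * (c * (c + h) ^ t)                          ≡⟨ x∙yz≈y∙xz (c + h) c _ ⟩
  c * ((c + h) * (c + h) ^ t)                          ∎
  where
  open ≤-Reasoning
  expand : ∀ c h t x → c * x * (c + suc t * h) + x * (t * h * h) ≡ (c + h) * (x * (c + t * h))
  expand = solve-∀

power-doubling : ∀ {c h t} → 1 ≤ c → c ≤ t * h → 2 * c ^ t ≤ (c + h) ^ t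
power-doubling {c} {h} {t} 1≤c c≤th = *-cancelˡ-≤ c {{>-nonZero 1≤c}} (begin
  c * (2 * c ^ t)        ≡⟨ rearrange c (c ^ t) ⟩
  c ^ t * (c + c)        ≤⟨ *-monoʳ-≤ (c ^ t) (+-monoʳ-≤ c c≤th) ⟩
  c ^ t * (c + t * h)    ≤⟨ bernoulli c h t ⟩
  c * (c + h) ^ t        ∎)
  where
  open ≤-Reasoning
  rearrange : ∀ c x → c * (2 * x) ≡ x * (c + c)
  rearrange = solve-∀

power-growth : ∀ {c h t j g} → 1 ≤ c → c ≤ t * h → t * j ≤ g → 2 ^ j * c ^ g ≤ (c + h) ^ g
power-growth {c} {h} {t} {j} {g} 1≤c c≤th tj≤g = begin
  2 ^ j * c ^ g                    ≡⟨ cong (λ e → 2 ^ j * c ^ e) (m+[n∸m]≡n tj≤g) ⟨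
  2 ^ j * c ^ (t * j + r)          ≡⟨ cong (2 ^ j *_) (^-distribˡ-+-* c (t * j) r) ⟩
  2 ^ j * (c ^ (t * j) * c ^ r)    ≡⟨ *-assoc (2 ^ j) (c ^ (t * j)) (c ^ r) ⟨
  2 ^ j * c ^ (t * j) * c ^ r      ≡⟨ cong (λ x → 2 ^ j * x * c ^ r) (^-*-assoc c t j) ⟨
  2 ^ j * (c ^ t) ^ j * c ^ r      ≡⟨ cong (_* c ^ r) (^-distribʳ-* 2 (c ^ t) j) ⟨
  (2 * c ^ t) ^ j * c ^ r          ≤⟨ *-mono-≤ (^-monoˡ-≤ j (power-doubling {c} {h} {t} 1≤c c≤th))
                                                (^-monoˡ-≤ r (m≤m+n c h)) ⟩
  ((c + h) ^ t) ^ j * (c + h) ^ r  ≡⟨ cong (_* (c + h) ^ r) (^-*-assoc (c + h) t j) ⟩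
  (c + h) ^ (t * j) * (c + h) ^ r  ≡⟨ ^-distribˡ-+-* (c + h) (t * j) r ⟨
  (c + h) ^ (t * j + r)            ≡⟨ cong ((c + h) ^_) (m+[n∸m]≡n tj≤g) ⟩
  (c + h) ^ g                      ∎
  where
  open ≤-Reasoning
  r : ℕ
  r = g ∸ t * j

-- At most h of the distinct xs lie below c + h; the remaining ones supply the factor 2 ^ j.
distinct-product-bound : ∀ {c h t j xs} → 1 ≤ c → c ≤ t * h → t * j + h ≤ length xs →
  Unique xs → All (c ≤_) xs → 2 ^ j * c ^ length xs ≤ product xs
distinct-product-bound {c} {h} {t} {j} {xs} 1≤c c≤th tj+h≤|xs| xs-unique c≤xs = begin
  2 ^ j * c ^ length xs           ≡⟨ cong (λ e → 2 ^ j * c ^ e) |lows|+|highs|≡|xs| ⟨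
  2 ^ j * c ^ (s + g)             ≡⟨ cong (2 ^ j *_) (^-distribˡ-+-* c s g) ⟩
  2 ^ j * (c ^ s * c ^ g)         ≡⟨ x∙yz≈y∙xz (2 ^ j) (c ^ s) (c ^ g) ⟩
  c ^ s * (2 ^ j * c ^ g)         ≤⟨ *-mono-≤ (^-length≤product (filter⁺ _ c≤xs))
                                       (≤-trans (power-growth {c} {h} {t} 1≤c c≤th tj≤g)
                                                (^-length≤product c+h≤highs)) ⟩
  product lows * product highs    ≡⟨ product-++ lows highs ⟨
  product (lows ++ highs)         ≡⟨ product-↭ (filter-++-∁-↭ low? xs) ⟩
  product xs                      ∎
  where
  open ≤-Reasoning
  low? : Decidable (_< c + h)
  low? = _<? c + h
  lows highs : List ℕ
  lows = filter low? xs
  highs = filter (∁? low?) xs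
  s g : ℕ
  s = length lows
  g = length highs
  |lows|+|highs|≡|xs| : s + g ≡ length xs
  |lows|+|highs|≡|xs| = ≡.trans (≡.sym (length-++ lows)) (↭-length (filter-++-∁-↭ low? xs))
  s≤h : s ≤ h
  s≤h = Unique-interval⇒length≤ (Unique.filter⁺ low? xs-unique)
          (All.zip (filter⁺ low? c≤xs , all-filter low? xs))
  tj≤g : t * j ≤ g
  tj≤g = +-cancelʳ-≤ h (t * j) g (begin
    t * j + h       ≤⟨ tj+h≤|xs| ⟩
    length xs       ≡⟨ |lows|+|highs|≡|xs| ⟨
    s + g           ≤⟨ +-monoˡ-≤ g s≤h ⟩
    h + g           ≡⟨ +-comm h g ⟩
    g + h           ∎)
  c+h≤highs : All (c + h ≤_) highs
  c+h≤highs = All.map ≮⇒≥ (all-filter (∁? low?) xs)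

-- In the next three bounds the slack term has nonnegative coefficients, so each is a ring identity.
cubic-bound : ∀ q → 1 ≤ q → 4 * (q * (2 + 4 * q * (2 * q + 3))) ≤ 88 * (q * q * q)
cubic-bound (suc k) _ = ≤-trans (m≤m+n _ _) (≤-reflexive (cubic-slack k))
  where
  cubic-slack : ∀ k → 4 * (suc k * (2 + 4 * suc k * (2 * suc k + 3))) + (56 * (k * k * k) + 120 * (k * k) + 64 * k)
                      ≡ 88 * (suc k * suc k * suc k)
  cubic-slack = solve-∀

quadratic-bound : ∀ L → 6 ≤ L → 24 + 2 * suc L * L + 4 * suc L * L ≤ 8 * (L * L)
quadratic-bound L 6≤L with k , refl ← m≤n⇒∃[o]m+o≡n 6≤L =
  ≤-trans (m≤m+n _ _) (≤-reflexive (quadratic-slack k))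
  where
  quadratic-slack : ∀ k → 24 + 2 * suc (6 + k) * (6 + k) + 4 * suc (6 + k) * (6 + k) + (2 * (k * k) + 18 * k + 12)
                          ≡ 8 * ((6 + k) * (6 + k))
  quadratic-slack = solve-∀

cube-step : ∀ n → 3 ≤ n → suc (suc n) * suc (suc n) * suc (suc n) ≤ 2 * (suc n * suc n * suc n)
cube-step n 3≤n with k , refl ← m≤n⇒∃[o]m+o≡n 3≤n = ≤-trans (m≤m+n _ _) (≤-reflexive (cube-slack k))
  where
  cube-slack : ∀ k → (5 + k) * (5 + k) * (5 + k) + (k * k * k + 9 * (k * k) + 21 * k + 3)
                     ≡ 2 * ((4 + k) * (4 + k) * (4 + k))
  cube-slack = solve-∀

100*cube≤2^ : ∀ l → 26 ≤ l → 100 * (suc l * suc l * suc l) ≤ 2 ^ l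
100*cube≤2^ l 26≤l with m≤n⇒m<n∨m≡n 26≤l
... | inj₂ refl = ≤ᵇ⇒≤ _ _ _
100*cube≤2^ (suc l) _ | inj₁ (s≤s 26≤l) = begin
  100 * (suc (suc l) * suc (suc l) * suc (suc l))  ≤⟨ *-monoʳ-≤ 100 (cube-step l (≤-trans (≤ᵇ⇒≤ 3 26 _) 26≤l)) ⟩
  100 * (2 * (suc l * suc l * suc l))              ≡⟨ x∙yz≈y∙xz 100 2 (suc l * suc l * suc l) ⟩
  2 * (100 * (suc l * suc l * suc l))              ≤⟨ *-monoʳ-≤ 2 (100*cube≤2^ l 26≤l) ⟩
  2 * 2 ^ l                                        ∎
  where
  open ≤-Reasoning

exponent-bound : ∀ {x y e k} → 2 ^ x ≤ 6 * y ^ e → y ≤ 2 ^ k → x < 3 + k * e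
exponent-bound {x} {y} {e} {k} 2^x≤6y^e y≤2^k = ^-cancelʳ-< 2 (begin-strict
  2 ^ x              ≤⟨ 2^x≤6y^e ⟩
  6 * y ^ e          ≤⟨ *-monoʳ-≤ 6 (^-monoˡ-≤ e y≤2^k) ⟩
  6 * (2 ^ k) ^ e    ≡⟨ cong (6 *_) (^-*-assoc 2 k e) ⟩
  6 * 2 ^ (k * e)    <⟨ *-monoˡ-< (2 ^ (k * e)) {{m^n≢0 2 (k * e)}} (n≤1+n 7) ⟩
  8 * 2 ^ (k * e)    ≡⟨ ^-distribˡ-+-* 2 3 (k * e) ⟨
  2 ^ (3 + k * e)    ∎)
  where open ≤-Reasoning

-- Few large prime divisors

-- If 2 * P < c * b for b distinct factors ≥ c with product
-- below 2 ^ c, then either b < t * j + h, and Chebyshev fails because q * h ≤ L / 2, or the factors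
-- ≥ c + h contribute an extra 2 ^ j ≥ 8 * L * L, and Chebyshev fails again.
module LargeFactors {L q P : ℕ} .{{_ : NonZero q}} (L<2^q : L < 2 ^ q)
  (100q³≤L : 100 * (q * q * q) ≤ L) (chebyshev-L : 2 ^ (L * L) ≤ 6 * L ^ (2 * (suc L + P))) where

  instance
    2q≢0 : NonZero (2 * q)
    2q≢0 = m*n≢0 2 q

  c t j h : ℕ
  c = suc L
  t = 4 * q
  j = 2 * q + 3
  h = L / (2 * q)

  1≤q : 1 ≤ q
  1≤q = >-nonZero⁻¹ q

  100q≤L : 100 * q ≤ L
  100q≤L = begin
    100 * q              ≤⟨ *-monoʳ-≤ 100 (m≤m*n q (q * q) {{m*n≢0 q q}}) ⟩
    100 * (q * (q * q))  ≡⟨ cong (100 *_) (*-assoc q q q) ⟨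
    100 * (q * q * q)    ≤⟨ 100q³≤L ⟩
    L                    ∎
    where open ≤-Reasoning

  2qh≤L : 2 * q * h ≤ L
  2qh≤L = subst (_≤ L) (*-comm h (2 * q)) (m/n*n≤m L (2 * q))

  c≤th : c ≤ t * h
  c≤th = +-cancelˡ-≤ (2 * r) c (t * h) (begin
    2 * r + suc L     ≡⟨ +-suc (2 * r) L ⟩
    suc (2 * r) + L   ≤⟨ +-monoˡ-≤ L 1+2r≤L ⟩
    L + L             ≡⟨ cong₂ _+_ L≡r+h*2q L≡r+h*2q ⟩
    (r + h * (2 * q)) + (r + h * (2 * q))  ≡⟨ regroup r h q ⟩
    2 * r + t * h     ∎)
    where
    open ≤-Reasoning
    r : ℕ
    r = L % (2 * q)
    L≡r+h*2q : L ≡ r + h * (2 * q)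
    L≡r+h*2q = m≡m%n+[m/n]*n L (2 * q)
    1+2r≤L : suc (2 * r) ≤ L
    1+2r≤L = begin
      suc (2 * r)    ≤⟨ n≤1+n _ ⟩
      2 + 2 * r      ≡⟨ *-suc 2 r ⟨
      2 * suc r      ≤⟨ *-monoʳ-≤ 2 (m%n<n L (2 * q)) ⟩
      2 * (2 * q)    ≡⟨ *-assoc 2 2 q ⟨
      4 * q          ≤⟨ *-monoˡ-≤ q {4} {100} (≤-trans (n≤1+n 4) (m≤m+n 5 95)) ⟩
      100 * q        ≤⟨ 100q≤L ⟩
      L              ∎
    regroup : ∀ r h q → (r + h * (2 * q)) + (r + h * (2 * q)) ≡ 2 * r + 4 * q * h
    regroup = solve-∀

  8L²≤2^j : 8 * (L * L) ≤ 2 ^ j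
  8L²≤2^j = begin
    8 * (L * L)          ≤⟨ *-monoʳ-≤ 8 (*-mono-≤ (<⇒≤ L<2^q) (<⇒≤ L<2^q)) ⟩
    8 * (2 ^ q * 2 ^ q)  ≡⟨ *-comm 8 (2 ^ q * 2 ^ q) ⟩
    2 ^ q * 2 ^ q * 8    ≡⟨ cong (_* 8) (^-distribˡ-+-* 2 q q) ⟨
    2 ^ (q + q) * 2 ^ 3  ≡⟨ ^-distribˡ-+-* 2 (q + q) 3 ⟨
    2 ^ (q + q + 3)      ≡⟨ cong (λ x → 2 ^ (q + x + 3)) (+-identityʳ q) ⟨
    2 ^ j                ∎
    where open ≤-Reasoning

  2≤L : 2 ≤ L
  2≤L = ≤-trans (m≤m+n 2 98) (≤-trans (m≤m*n 100 q) 100q≤L)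

  instance
    L≢0 : NonZero L
    L≢0 = >-nonZero (≤-trans (n≤1+n 1) 2≤L)

  few-factors-exponent≤L*L : 3 + q * c * (2 + t * j) + c * (q * h) ≤ L * L
  few-factors-exponent≤L*L = *-cancelˡ-≤ 8 (begin
    8 * (3 + q * c * (2 + t * j) + c * (q * h))
      ≡⟨ distribute q c h ⟩
    24 + 2 * c * (4 * (q * (2 + t * j))) + 4 * c * (2 * q * h)
      ≤⟨ +-mono-≤ (+-monoʳ-≤ 24 (*-monoʳ-≤ (2 * c) 4A≤L)) (*-monoʳ-≤ (4 * c) 2qh≤L) ⟩
    24 + 2 * c * L + 4 * c * L
      ≤⟨ quadratic-bound L (≤-trans (m≤m+n 6 94) (≤-trans (m≤m*n 100 q) 100q≤L)) ⟩
    8 * (L * L) ∎)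
    where
    open ≤-Reasoning
    distribute : ∀ q c h → 8 * (3 + q * c * (2 + 4 * q * (2 * q + 3)) + c * (q * h))
                           ≡ 24 + 2 * c * (4 * (q * (2 + 4 * q * (2 * q + 3)))) + 4 * c * (2 * q * h)
    distribute = solve-∀
    4A≤L : 4 * (q * (2 + t * j)) ≤ L
    4A≤L = ≤-trans (cubic-bound q 1≤q) (≤-trans (*-monoˡ-≤ (q * q * q) (m≤m+n 88 12)) 100q³≤L)

  2P<cb⇒tj+h≤b : ∀ {b} → 2 * P < c * b → t * j + h ≤ b
  2P<cb⇒tj+h≤b {b} 2P<cb = ≮⇒≥ λ b<tj+h →
    <⇒≱ (exponent-bound {L * L} {L} {2 * (c + P)} {q} chebyshev-L (<⇒≤ L<2^q)) (begin
      3 + q * (2 * (c + P))               ≡⟨ cong (λ x → 3 + q * x) (*-distribˡ-+ 2 c P) ⟩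
      3 + q * (2 * c + 2 * P)             ≤⟨ +-monoʳ-≤ 3 (*-monoʳ-≤ q (+-monoʳ-≤ (2 * c)
                                               (≤-trans (<⇒≤ 2P<cb) (*-monoʳ-≤ c (b≤h+tj b<tj+h))))) ⟩
      3 + q * (2 * c + c * (h + t * j))   ≡⟨ regroup q c h (t * j) ⟩
      3 + q * c * (2 + t * j) + c * (q * h) ≤⟨ few-factors-exponent≤L*L ⟩
      L * L                               ∎)
    where
    open ≤-Reasoning
    b≤h+tj : b < t * j + h → b ≤ h + t * j
    b≤h+tj b<tj+h = subst (b ≤_) (+-comm (t * j) h) (<⇒≤ b<tj+h)
    regroup : ∀ q c h x → 3 + q * (2 * c + c * (h + x)) ≡ 3 + q * c * (2 + x) + c * (q * h)
    regroup = solve-∀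

  L^[1+e]≤L^[2c]*[c^b]^c : ∀ {b} → 2 * P < c * b → L * L ^ (2 * (c + P)) ≤ L ^ (2 * c) * (c ^ b) ^ c
  L^[1+e]≤L^[2c]*[c^b]^c {b} 2P<cb = begin
    L ^ suc (2 * (c + P))        ≡⟨ cong (L ^_) (exponent-shift c P) ⟩
    L ^ (2 * c + suc (2 * P))    ≤⟨ ^-monoʳ-≤ L (+-monoʳ-≤ (2 * c) 2P<cb) ⟩
    L ^ (2 * c + c * b)          ≡⟨ ^-distribˡ-+-* L (2 * c) (c * b) ⟩
    L ^ (2 * c) * L ^ (c * b)    ≤⟨ *-monoʳ-≤ (L ^ (2 * c)) (^-monoˡ-≤ (c * b) (n≤1+n L)) ⟩
    L ^ (2 * c) * c ^ (c * b)    ≡⟨ cong (λ x → L ^ (2 * c) * c ^ x) (*-comm c b) ⟩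
    L ^ (2 * c) * c ^ (b * c)    ≡⟨ cong (L ^ (2 * c) *_) (^-*-assoc c b c) ⟨
    L ^ (2 * c) * (c ^ b) ^ c    ∎
    where
    open ≤-Reasoning
    exponent-shift : ∀ c P → suc (2 * (c + P)) ≡ 2 * c + suc (2 * P)
    exponent-shift = solve-∀

  8^c*L^[2c]*[c^b]^c<2^[c*c] : ∀ {b} → 2 ^ j * c ^ b < 2 ^ c → 8 ^ c * (L ^ (2 * c) * (c ^ b) ^ c) < 2 ^ (c * c)
  8^c*L^[2c]*[c^b]^c<2^[c*c] {b} 2^j*c^b<2^c = begin-strict
    8 ^ c * (L ^ (2 * c) * (c ^ b) ^ c)  ≡⟨ cong (λ x → 8 ^ c * (x * (c ^ b) ^ c)) (^-double L c) ⟩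
    8 ^ c * ((L * L) ^ c * (c ^ b) ^ c)  ≡⟨ *-assoc (8 ^ c) ((L * L) ^ c) ((c ^ b) ^ c) ⟨
    8 ^ c * (L * L) ^ c * (c ^ b) ^ c    ≡⟨ cong (_* (c ^ b) ^ c) (^-distribʳ-* 8 (L * L) c) ⟨
    (8 * (L * L)) ^ c * (c ^ b) ^ c      ≡⟨ ^-distribʳ-* (8 * (L * L)) (c ^ b) c ⟨
    (8 * (L * L) * c ^ b) ^ c            ≤⟨ ^-monoˡ-≤ c (*-monoˡ-≤ (c ^ b) 8L²≤2^j) ⟩
    (2 ^ j * c ^ b) ^ c                  <⟨ ^-monoˡ-< c 2^j*c^b<2^c ⟩
    (2 ^ c) ^ c                          ≡⟨ ^-*-assoc 2 c c ⟩
    2 ^ (c * c)                          ∎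
    where open ≤-Reasoning

  6*2^[1+2L]≤8^c*L : 6 * 2 ^ suc (2 * L) ≤ 8 ^ c * L
  6*2^[1+2L]≤8^c*L = begin
    6 * (2 * 2 ^ (2 * L))  ≡⟨ cong (λ x → 6 * (2 * x)) (^-double 2 L) ⟩
    6 * (2 * 4 ^ L)        ≡⟨ *-assoc 6 2 (4 ^ L) ⟨
    12 * 4 ^ L             ≤⟨ *-mono-≤ (m≤m+n 12 4) (^-monoˡ-≤ L (m≤m+n 4 4)) ⟩
    16 * 8 ^ L             ≡⟨ *-comm 16 (8 ^ L) ⟩
    8 ^ L * 16             ≡⟨ *-assoc (8 ^ L) 8 2 ⟨
    8 ^ L * 8 * 2          ≤⟨ *-monoʳ-≤ (8 ^ L * 8) 2≤L ⟩
    8 ^ L * 8 * L          ≡⟨ cong (_* L) (*-comm (8 ^ L) 8) ⟩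
    8 ^ c * L              ∎
    where open ≤-Reasoning

  2P<cb⇒2^c≤2^j*c^b : ∀ {b} → 2 * P < c * b → 2 ^ c ≤ 2 ^ j * c ^ b
  2P<cb⇒2^c≤2^j*c^b {b} 2P<cb = ≮⇒≥ λ 2^j*c^b<2^c → <⇒≱ (*-cancelˡ-< (2 ^ (L * L)) _ _ (begin-strict
    2 ^ (L * L) * (8 ^ c * L)                   ≤⟨ *-monoˡ-≤ (8 ^ c * L) chebyshev-L ⟩
    6 * L ^ (2 * (c + P)) * (8 ^ c * L)         ≡⟨ rearrange 6 (L ^ (2 * (c + P))) (8 ^ c) L ⟩
    6 * (8 ^ c * (L * L ^ (2 * (c + P))))       ≤⟨ *-monoʳ-≤ 6 (*-monoʳ-≤ (8 ^ c)
                                                     (L^[1+e]≤L^[2c]*[c^b]^c {b} 2P<cb)) ⟩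
    6 * (8 ^ c * (L ^ (2 * c) * (c ^ b) ^ c))   <⟨ *-monoʳ-< 6 (8^c*L^[2c]*[c^b]^c<2^[c*c] {b} 2^j*c^b<2^c) ⟩
    6 * 2 ^ (c * c)                             ≡⟨ cong (λ x → 6 * 2 ^ x) (square-suc L) ⟩
    6 * 2 ^ (L * L + suc (2 * L))               ≡⟨ cong (6 *_) (^-distribˡ-+-* 2 (L * L) (suc (2 * L))) ⟩
    6 * (2 ^ (L * L) * 2 ^ suc (2 * L))         ≡⟨ x∙yz≈y∙xz 6 (2 ^ (L * L)) (2 ^ suc (2 * L)) ⟩
    2 ^ (L * L) * (6 * 2 ^ suc (2 * L))         ∎)) 6*2^[1+2L]≤8^c*L
    where
    open ≤-Reasoning
    rearrange : ∀ a x y z → a * x * (y * z) ≡ a * (y * (z * x))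
    rearrange = solve-∀
    square-suc : ∀ L → suc L * suc L ≡ L * L + suc (2 * L)
    square-suc = solve-∀

  c*|xs|≤2P : ∀ {xs} → Unique xs → All (c ≤_) xs → product xs < 2 ^ c → c * length xs ≤ 2 * P
  c*|xs|≤2P xs-unique c≤xs Πxs<2^c = ≮⇒≥ λ 2P<cb →
    <⇒≱ Πxs<2^c (≤-trans (2P<cb⇒2^c≤2^j*c^b 2P<cb)
      (distinct-product-bound {c} {h} {t} {j} (s≤s z≤n) c≤th (2P<cb⇒tj+h≤b 2P<cb) xs-unique c≤xs))

rare-large-prime-divisors : ∀ {L d} → 2 ^ 26 ≤ L → 1 ≤ d → d < 2 ^ suc L →
  ∀ Ps → (∀ {p} → Prime p → L < p → p ≤ L * L → p ∈ Ps) →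
  ∀ {ps} → Unique ps → All Prime ps → All (L <_) ps → All (_∣ d) ps →
  suc L * length ps ≤ 2 * length Ps
rare-large-prime-divisors {L} {d} 2^26≤L 1≤d d<2^[1+L] Ps primes∈Ps ps-unique ps-prime L<ps ps∣d
  with l , 2^l≤L , L<2^[1+l] ← integer-log 2 ≤-refl L (≤-trans (m^n>0 2 26) 2^26≤L)
  = LargeFactors.c*|xs|≤2P {L} {suc l} {length Ps} L<2^[1+l] 100q³≤L chebyshev-L ps-unique L<ps
      (≤-<-trans (∣⇒≤ {{>-nonZero 1≤d}} (product-∣ ps-prime ps-unique ps∣d)) d<2^[1+L])
  where
  2≤L : 2 ≤ L
  2≤L = ≤-trans (^-monoʳ-≤ 2 {1} {26} (s≤s z≤n)) 2^26≤L
  100q³≤L : 100 * (suc l * suc l * suc l) ≤ L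
  100q³≤L = ≤-trans (100*cube≤2^ l (≤-pred (^-cancelʳ-< 2 {26} {suc l} (≤-<-trans 2^26≤L L<2^[1+l]))))
              2^l≤L
  S : List ℕ
  S = upTo (suc L) ++ Ps
  primes∈S : ∀ {p} → Prime p → p ≤ L * L → p ∈ S
  primes∈S {p} p-prime p≤L*L with p ≤? L
  ... | yes p≤L = ∈-++⁺ˡ (∈-upTo⁺ (s≤s p≤L))
  ... | no  p≰L = ∈-++⁺ʳ (upTo (suc L)) (primes∈Ps p-prime (≰⇒> p≰L) p≤L*L)
  chebyshev-L : 2 ^ (L * L) ≤ 6 * L ^ (2 * (suc L + length Ps))
  chebyshev-L = begin
    2 ^ (L * L)                         ≤⟨ chebyshev S (*-mono-≤ 2≤L (≤-trans (n≤1+n 1) 2≤L)) primes∈S ⟩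
    6 * (L * L) ^ length S              ≡⟨ cong (λ e → 6 * (L * L) ^ e) |S| ⟩
    6 * (L * L) ^ (suc L + length Ps)   ≡⟨ cong (6 *_) (^-double L (suc L + length Ps)) ⟨
    6 * L ^ (2 * (suc L + length Ps))   ∎
    where
    open ≤-Reasoning
    |S| : length S ≡ suc L + length Ps
    |S| = ≡.trans (length-++ (upTo (suc L))) (cong (_+ length Ps) (length-upTo (suc L)))

length-concatMap-map : ∀ {A B C : Set} (f : A → B → C) xs ys →
  length (concatMap (λ x → map (f x) ys) xs) ≡ length xs * length ys
length-concatMap-map f [] ys = refl
length-concatMap-map f (x ∷ xs) ys = begin
  length (map (f x) ys ++ concatMap (λ x → map (f x) ys) xs)
    ≡⟨ length-++ (map (f x) ys) ⟩
  length (map (f x) ys) + length (concatMap (λ x → map (f x) ys) xs)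
    ≡⟨ cong₂ _+_ (length-map (f x) ys) (length-concatMap-map f xs ys) ⟩
  length ys + length xs * length ys ∎
  where open ≡-Reasoning

length-allFuns : ∀ k m → length (allFuns k m) ≡ m ^ k
length-allFuns zero m = refl
length-allFuns (suc k) m = begin
  length (concatMap (λ i → map (consF i) (allFuns k m)) (allFin m))
    ≡⟨ length-concatMap-map consF (allFin m) (allFuns k m) ⟩
  length (allFin m) * length (allFuns k m)
    ≡⟨ cong₂ _*_ (length-tabulate {n = m} id) (length-allFuns k m) ⟩
  m * m ^ k ∎
  where open ≡-Reasoning

hom≤order^order : ∀ F G → hom F G ≤ order G ^ order F
hom≤order^order F G = subst (hom F G ≤_) (length-allFuns (order F) (order G))
  (length-filter _ (allFuns (order F) (order G)))

hom≤ : ∀ F G {n N} → 1 ≤ n → order G ≤ n → order F ≤ N → hom F G ≤ n ^ N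
hom≤ F G {n} {N} 1≤n |G|≤n |F|≤N = begin
  hom F G             ≤⟨ hom≤order^order F G ⟩
  order G ^ order F   ≤⟨ ^-monoˡ-≤ (order F) |G|≤n ⟩
  n ^ order F         ≤⟨ ^-monoʳ-≤ n {{>-nonZero 1≤n}} |F|≤N ⟩
  n ^ N               ∎
  where open ≤-Reasoning

2≤m^n⇒1≤m : ∀ m n → 2 ≤ m ^ n → 1 ≤ m
2≤m^n⇒1≤m zero    zero    (s≤s ())
2≤m^n⇒1≤m zero    (suc n) ()
2≤m^n⇒1≤m (suc m) _       _ = s≤s z≤n

square-cancel-≤ : ∀ {m n} → m * m ≤ n * n → m ≤ n
square-cancel-≤ m*m≤n*n = ≮⇒≥ λ n<m → <⇒≱ (*-mono-< n<m n<m) m*m≤n*n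

module _ {N n : ℕ} (e^2000≤log₂M : LogGeE2000 (n ^ N)) (𝓕 : GraphClass) (G H : Graph)
  (|G|≤n : order G ≤ n) (|H|≤n : order H ≤ n)
  {Ps : List ℕ} (Ps-spec : ∀ p → p ∈ Ps ⇔ (Prime p × LogLt (n ^ N) p × LeLogSq p (n ^ N)))
  {Bad : List ℕ} (Bad-unique : Unique Bad)
  (Bad-spec : ∀ p → p ∈ Bad ⇔ (p ∈ Ps × HomEquivModLe p 𝓕 N G H)) where

  M : ℕ
  M = n ^ N
  -- Only the partial sum 2 ≤ e (k = 1) of the hypothesis is used.
  2^2^2000≤M : 2 ^ (eNum 1 ^ 2000) ≤ M
  2^2^2000≤M = ≤-trans (e^2000≤log₂M 1) (≤-reflexive (*-identityʳ M))

  log₂M : ∃[ L ] 2 ^ L ≤ M × M < 2 ^ suc L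
  log₂M = integer-log 2 ≤-refl M (≤-trans (m^n>0 2 (eNum 1 ^ 2000)) 2^2^2000≤M)

  L : ℕ
  L = proj₁ log₂M

  2^L≤M : 2 ^ L ≤ M
  2^L≤M = proj₁ (proj₂ log₂M)

  M<2^[1+L] : M < 2 ^ suc L
  M<2^[1+L] = proj₂ (proj₂ log₂M)

  2^26≤L : 2 ^ 26 ≤ L
  2^26≤L = ≤-trans (^-monoʳ-≤ 2 {26} {2000} (≤ᵇ⇒≤ _ _ _))
             (≤-pred (^-cancelʳ-< 2 {eNum 1 ^ 2000} {suc L} (≤-<-trans 2^2^2000≤M M<2^[1+L])))

  1≤n : 1 ≤ n
  1≤n = 2≤m^n⇒1≤m n N (≤-trans (^-monoʳ-≤ 2 {1} {L} (≤-trans (m^n>0 2 26) 2^26≤L)) 2^L≤M)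

  large-primes∈Ps : ∀ {p} → Prime p → L < p → p ≤ L * L → p ∈ Ps
  large-primes∈Ps {p} p-prime L<p p≤L*L =
    Equivalence.from (Ps-spec p) (p-prime , <-≤-trans M<2^[1+L] (^-monoʳ-≤ 2 L<p) , √p≤log₂M)
    where
    √p≤log₂M : LeLogSq p M
    √p≤log₂M a b _ a*a≤p*b*b = begin
      2 ^ a         ≤⟨ ^-monoʳ-≤ 2 a≤L*b ⟩
      2 ^ (L * b)   ≡⟨ ^-*-assoc 2 L b ⟨
      (2 ^ L) ^ b   ≤⟨ ^-monoˡ-≤ b 2^L≤M ⟩
      M ^ b         ∎
      where
      open ≤-Reasoning
      a≤L*b : a ≤ L * b
      a≤L*b = square-cancel-≤ (begin
        a * a             ≤⟨ a*a≤p*b*b ⟩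
        p * (b * b)       ≤⟨ *-monoˡ-≤ (b * b) p≤L*L ⟩
        L * L * (b * b)   ≡⟨ interchange L L b b ⟩
        L * b * (L * b)   ∎)

  module _ (F : Graph) (F∈𝓕 : 𝓕 F) (|F|≤N : order F ≤ N) (homs≢ : hom F G ≢ hom F H) where

    d : ℕ
    d = ∣ hom F G - hom F H ∣

    1≤d : 1 ≤ d
    1≤d = n≢0⇒n>0 (homs≢ ∘ ∣m-n∣≡0⇒m≡n)

    d<2^[1+L] : d < 2 ^ suc L
    d<2^[1+L] = ≤-<-trans (≤-trans (∣m-n∣≤m⊔n (hom F G) (hom F H))
                            (⊔-lub (hom≤ F G 1≤n |G|≤n |F|≤N) (hom≤ F H 1≤n |H|≤n |F|≤N)))
                  M<2^[1+L]

    bad-prime : ∀ {p} → p ∈ Bad → Prime p × L < p × p ∣ d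
    bad-prime {p} p∈Bad = p-prime , ^-cancelʳ-< 2 {L} {p} (≤-<-trans 2^L≤M M<2^p) , p∣homs F F∈𝓕 |F|≤N
      where
      p∈Ps : p ∈ Ps
      p∈Ps = proj₁ (Equivalence.to (Bad-spec p) p∈Bad)
      p∣homs : HomEquivModLe p 𝓕 N G H
      p∣homs = proj₂ (Equivalence.to (Bad-spec p) p∈Bad)
      p-prime : Prime p
      p-prime = proj₁ (Equivalence.to (Ps-spec p) p∈Ps)
      M<2^p : M < 2 ^ p
      M<2^p = proj₁ (proj₂ (Equivalence.to (Ps-spec p) p∈Ps))

    separating-graph⇒bound : M ^ length Bad ≤ 2 ^ (2 * length Ps)
    separating-graph⇒bound = begin
      M ^ length Bad               ≤⟨ ^-monoˡ-≤ (length Bad) (<⇒≤ M<2^[1+L]) ⟩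
      (2 ^ suc L) ^ length Bad     ≡⟨ ^-*-assoc 2 (suc L) (length Bad) ⟩
      2 ^ (suc L * length Bad)     ≤⟨ ^-monoʳ-≤ 2
                                        (rare-large-prime-divisors 2^26≤L 1≤d d<2^[1+L] Ps large-primes∈Ps
                                        Bad-unique (All.tabulate (proj₁ ∘ bad-prime))
                                        (All.tabulate (proj₁ ∘ proj₂ ∘ bad-prime))
                                        (All.tabulate (proj₂ ∘ proj₂ ∘ bad-prime))) ⟩
      2 ^ (2 * length Ps)          ∎
      where open ≤-Reasoning

-- ¬ HomEquivLe yields no separating F constructively, but the goal is decidable, so we argue by
-- contradiction. Uniqueness of Ps is not needed: repeated entries only weaken the bound.
lemma28 : (N n : ℕ) → LogGeE2000 (n ^ N) →
    (𝓕 : GraphClass) (G H : Graph) → order G ≤ n → order H ≤ n →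
    ¬ HomEquivLe 𝓕 N G H →
    (Ps : List ℕ) → Unique Ps →
    (∀ p → p ∈ Ps ⇔ (Prime p × LogLt (n ^ N) p × LeLogSq p (n ^ N))) →
    (Bad : List ℕ) → Unique Bad →
    (∀ p → p ∈ Bad ⇔ (p ∈ Ps × HomEquivModLe p 𝓕 N G H)) →
    (n ^ N) ^ length Bad ≤ 2 ^ (2 * length Ps)
lemma28 N n e^2000≤log₂M 𝓕 G H |G|≤n |H|≤n G≢H Ps _ Ps-spec Bad Bad-unique Bad-spec =
  decidable-stable (_ ≤? _) λ bound-fails → G≢H λ F F∈𝓕 |F|≤N →
    decidable-stable (hom F G ≟ hom F H) λ homs≢ →
      bound-fails (separating-graph⇒bound e^2000≤log₂M 𝓕 G H |G|≤n |H|≤n Ps-spec Bad-unique Bad-spec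
                     F F∈𝓕 |F|≤N homs≢)
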